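{- Let $G$ be a finite simple graph with $\nu(G)=0$, let $u$ be a vertex of $G$, let $\mathbf{p}$ be the solving pattern for $\overline{\mathbf{x}_{\{u\}}}$, and let $\mathbf{s}$ be the odd dominating pattern of $G$. Then $\overline{\mathbf{x}_{N[u]}}\cdot\mathbf{p}=pr(\mathbf{s})$ if $u$ is never activated, and $\overline{\mathbf{x}_{N[u]}}\cdot\mathbf{p}=1-pr(\mathbf{s})$ if $u$ is always activated.
   Context: For $G$ with vertex set $V=\{v_1,\dots,v_n\}$, $N=N(G)$ is the closed neighborhood matrix over $\mathbb{Z}_2$ (entry $(i,j)$ is $1$ iff $i=j$ or $v_iv_j$ is an edge), $\nu(G)=\dim\ker N$; when $\nu(G)=0$, $N$ is invertible so every configuration has a unique solving pattern. Subsets $A\subseteq V$ are identified with characteristic vectors $\mathbf{x}_A$; $\mathbf{x}\cdot\mathbf{y}=\mathbf{x}^t\mathbf{y}$ over $\mathbb{Z}_2$; $\mathbf{1}$ is the all-ones vector and $\overline{\mathbf{x}}:=\mathbf{x}+\mathbf{1}$. $N[u]$ is the closed neighborhood of $u$ ($u$ together with its neighbors). A pattern $\mathbf{p}$ solves $\mathbf{c}$ if $N\mathbf{p}=\mathbf{c}$; the odd dominating pattern is the solution of $N\mathbf{s}=\mathbf{1}$. The parity value is $pr(\mathbf{x}):=\mathbf{1}\cdot\mathbf{x}$. A vertex $u$ is always activated if $\mathbf{s}(u)=1$ and never activated if $\mathbf{s}(u)=0$. -}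

module Defs where

open import Data.Nat using (ℕ)
open import Data.Bool using (Bool; true; false; _xor_; _∧_; _∨_; not)
open import Data.Fin using (Fin)
open import Data.Fin.Properties using (_≟_)
open import Data.List using (foldr; allFin)
open import Relation.Nullary.Decidable using (⌊_⌋)
open import Relation.Binary.PropositionalEquality using (_≡_)

-- Vectors over Z₂ = Bool (false = 0, true = 1, _xor_ = +, _∧_ = ·)
Vec₂ : ℕ → Set
Vec₂ n = Fin n → Bool

record SimpleGraph (n : ℕ) : Set where
  field
    adj   : Fin n → Fin n → Bool
    sym   : ∀ i j → adj i j ≡ adj j i
    irrefl : ∀ i → adj i i ≡ false
open SimpleGraph public

Σ₂ : ∀ {n} → (Fin n → Bool) → Bool
Σ₂ {n} f = foldr (λ i acc → f i xor acc) false (allFin n)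

_·_ : ∀ {n} → Vec₂ n → Vec₂ n → Bool
x · y = Σ₂ (λ i → x i ∧ y i)

𝟏 : ∀ {n} → Vec₂ n
𝟏 _ = true

‾ : ∀ {n} → Vec₂ n → Vec₂ n
‾ x i = x i xor true

Nmat : ∀ {n} → SimpleGraph n → Fin n → Fin n → Bool
Nmat G i j = ⌊ i ≟ j ⌋ ∨ adj G i j

_⊛_ : ∀ {n} → (Fin n → Fin n → Bool) → Vec₂ n → Vec₂ n
(M ⊛ p) i = Σ₂ (λ j → M i j ∧ p j)

𝟎 : ∀ {n} → Vec₂ n
𝟎 _ = false

-- ν(G) = dim ker N(G) = 0, i.e. ker N(G) is trivial
ν≡0 : ∀ {n} → SimpleGraph n → Set
ν≡0 {n} G = ∀ (x : Vec₂ n) → (∀ i → (Nmat G ⊛ x) i ≡ false) → ∀ i → x i ≡ false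

Solves : ∀ {n} → SimpleGraph n → Vec₂ n → Vec₂ n → Set
Solves G p c = ∀ i → (Nmat G ⊛ p) i ≡ c i

x[_] : ∀ {n} → Fin n → Vec₂ n
x[ u ] v = ⌊ u ≟ v ⌋

xN[_,_] : ∀ {n} → SimpleGraph n → Fin n → Vec₂ n
xN[ G , u ] v = Nmat G u v

pr : ∀ {n} → Vec₂ n → Bool
pr x = 𝟏 · x

-- Since N is symmetric, the parity of any pattern p solving a configuration c is
-- 1·p = (N s)·p = s·(N p) = s·c. For c the complement of x_{u} this gives
-- pr(p) = pr(s) + s(u), while the complement of x_{N[u]} pairs with p to
-- (N p)(u) + pr(p) = 0 + pr(p).
module Submission where

open import Defs hiding (sym)
open import Data.Nat using (ℕ)
open import Data.Fin using (Fin; zero; suc; punchIn)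
open import Data.Fin.Properties using (_≟_; punchInᵢ≢i)
open import Data.Bool using (Bool; true; false; not; _xor_; _∧_; _∨_)
open import Data.Bool.Properties
  using (∧-comm; ∧-assoc; ∧-distribʳ-xor; xor-identityʳ; xor-∧-commutativeRing)
open import Data.List using (foldr; tabulate)
open import Data.Product using (_×_; _,_)
open import Function using (_∘_; mk⇔)
open import Relation.Nullary.Decidable using (isYes≗does; dec-true; dec-false; does-⇔)
open import Relation.Binary.PropositionalEquality
  using (_≡_; _≢_; _≗_; refl; sym; trans; cong; cong₂; module ≡-Reasoning)
open import Algebra.Bundles using (CommutativeRing)

open CommutativeRing xor-∧-commutativeRing using (semiring)
open import Algebra.Properties.Semiring.Sum semiring
  using (sum; sum-cong-≗; sum-remove; sum-replicate-zero; ∑-distrib-+; ∑-comm; *-distribˡ-sum; *-distribʳ-sum)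

private
  variable
    n : ℕ

foldr-tabulate : ∀ {m} (g : Fin n → Fin m) (f : Fin m → Bool) →
                 foldr (λ i acc → f i xor acc) false (tabulate g) ≡ sum (f ∘ g)
foldr-tabulate {ℕ.zero}  g f = refl
foldr-tabulate {ℕ.suc n} g f = cong (f (g zero) xor_) (foldr-tabulate (g ∘ suc) f)

Σ₂≡sum : (f : Vec₂ n) → Σ₂ f ≡ sum f
Σ₂≡sum = foldr-tabulate (λ i → i)

Σ₂-cong : {f g : Vec₂ n} → f ≗ g → Σ₂ f ≡ Σ₂ g
Σ₂-cong {f = f} {g} f≗g = trans (Σ₂≡sum f) (trans (sum-cong-≗ f≗g) (sym (Σ₂≡sum g)))

Σ₂-distrib-xor : (f g : Vec₂ n) → Σ₂ (λ i → f i xor g i) ≡ Σ₂ f xor Σ₂ g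
Σ₂-distrib-xor f g = trans (Σ₂≡sum (λ i → f i xor g i)) (trans (∑-distrib-+ f g) (sym (cong₂ _xor_ (Σ₂≡sum f) (Σ₂≡sum g))))

·-comm : (x y : Vec₂ n) → x · y ≡ y · x
·-comm x y = Σ₂-cong (λ i → ∧-comm (x i) (y i))

‾-· : (x y : Vec₂ n) → ‾ x · y ≡ (x · y) xor pr y
‾-· x y = trans (Σ₂-cong (λ i → ∧-distribʳ-xor (y i) (x i) true)) (Σ₂-distrib-xor (λ i → x i ∧ y i) y)

x[]-self : (u : Fin n) → x[ u ] u ≡ true
x[]-self u = trans (isYes≗does (u ≟ u)) (dec-true (u ≟ u) refl)

x[]-off : {u v : Fin n} → u ≢ v → x[ u ] v ≡ false
x[]-off {u = u} {v} u≢v = trans (isYes≗does (u ≟ v)) (dec-false (u ≟ v) u≢v)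

x[]-sym : (u v : Fin n) → x[ u ] v ≡ x[ v ] u
x[]-sym u v = trans (isYes≗does (u ≟ v)) (trans (does-⇔ (mk⇔ sym sym) (u ≟ v) (v ≟ u)) (sym (isYes≗does (v ≟ u))))

x[]-· : (u : Fin n) (y : Vec₂ n) → x[ u ] · y ≡ y u
x[]-· {ℕ.suc n} u y = begin
  x[ u ] · y                                     ≡⟨ Σ₂≡sum t ⟩
  sum t                                          ≡⟨ sum-remove {i = u} t ⟩
  t u xor sum (t ∘ punchIn u)                    ≡⟨ cong₂ _xor_ t-at-u (sum-cong-≗ {y = λ _ → false} t-off-u) ⟩
  y u xor sum {n} (λ _ → false)                  ≡⟨ cong (y u xor_) (sum-replicate-zero n) ⟩
  y u xor false                                  ≡⟨ xor-identityʳ (y u) ⟩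
  y u                                            ∎
  where
  open ≡-Reasoning
  t : Vec₂ (ℕ.suc n)
  t i = x[ u ] i ∧ y i
  t-at-u : t u ≡ y u
  t-at-u = cong (_∧ y u) (x[]-self u)
  t-off-u : ∀ j → t (punchIn u j) ≡ false
  t-off-u j = cong (_∧ y (punchIn u j)) (x[]-off (punchInᵢ≢i u j ∘ sym))

SymmetricMatrix : (Fin n → Fin n → Bool) → Set
SymmetricMatrix M = ∀ i j → M i j ≡ M j i

⊛-selfAdjoint : {M : Fin n → Fin n → Bool} → SymmetricMatrix M →
                (a b : Vec₂ n) → (M ⊛ a) · b ≡ a · (M ⊛ b)
⊛-selfAdjoint {M = M} M-sym a b = begin
  (M ⊛ a) · b                                              ≡⟨ Σ₂≡sum (λ i → (M ⊛ a) i ∧ b i) ⟩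
  sum (λ i → (M ⊛ a) i ∧ b i)                              ≡⟨ sum-cong-≗ (λ i → distribʳ i) ⟩
  sum (λ i → sum (λ j → (M i j ∧ a j) ∧ b i))              ≡⟨ ∑-comm (λ i j → (M i j ∧ a j) ∧ b i) ⟩
  sum (λ j → sum (λ i → (M i j ∧ a j) ∧ b i))              ≡⟨ sum-cong-≗ (λ j → sum-cong-≗ (λ i → transpose i j)) ⟩
  sum (λ j → sum (λ i → a j ∧ (M j i ∧ b i)))              ≡⟨ sum-cong-≗ (λ j → sym (distribˡ j)) ⟩
  sum (λ j → a j ∧ (M ⊛ b) j)                              ≡⟨ sym (Σ₂≡sum (λ j → a j ∧ (M ⊛ b) j)) ⟩
  a · (M ⊛ b)                                              ∎
  where
  open ≡-Reasoning
  distribʳ : ∀ i → (M ⊛ a) i ∧ b i ≡ sum (λ j → (M i j ∧ a j) ∧ b i)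
  distribʳ i = trans (cong (_∧ b i) (Σ₂≡sum (λ j → M i j ∧ a j))) (*-distribʳ-sum (b i) (λ j → M i j ∧ a j))
  distribˡ : ∀ j → a j ∧ (M ⊛ b) j ≡ sum (λ i → a j ∧ (M j i ∧ b i))
  distribˡ j = trans (cong (a j ∧_) (Σ₂≡sum (λ i → M j i ∧ b i))) (*-distribˡ-sum (a j) (λ i → M j i ∧ b i))
  transpose : ∀ i j → (M i j ∧ a j) ∧ b i ≡ a j ∧ (M j i ∧ b i)
  transpose i j = trans (cong (λ m → (m ∧ a j) ∧ b i) (M-sym i j))
                        (trans (cong (_∧ b i) (∧-comm (M j i) (a j))) (∧-assoc (a j) (M j i) (b i)))

Nmat-symmetric : (G : SimpleGraph n) → SymmetricMatrix (Nmat G)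
Nmat-symmetric G i j = cong₂ _∨_ (x[]-sym i j) (SimpleGraph.sym G i j)

pr-solution : (G : SimpleGraph n) {s p c : Vec₂ n} → Solves G s 𝟏 → Solves G p c → pr p ≡ s · c
pr-solution G {s} {p} {c} s-odd p-solves = begin
  𝟏 · p                ≡⟨ Σ₂-cong (λ i → cong (_∧ p i) (sym (s-odd i))) ⟩
  (Nmat G ⊛ s) · p     ≡⟨ ⊛-selfAdjoint (Nmat-symmetric G) s p ⟩
  s · (Nmat G ⊛ p)     ≡⟨ Σ₂-cong (λ i → cong (s i ∧_) (p-solves i)) ⟩
  s · c                ∎
  where open ≡-Reasoning

‾xN·p≡s[u]⊕pr[s] : (G : SimpleGraph n) (u : Fin n) {p s : Vec₂ n} →
                   Solves G p (‾ x[ u ]) → Solves G s 𝟏 → ‾ xN[ G , u ] · p ≡ s u xor pr s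
‾xN·p≡s[u]⊕pr[s] G u {p} {s} p-solves s-odd = begin
  ‾ xN[ G , u ] · p            ≡⟨ ‾-· xN[ G , u ] p ⟩
  (Nmat G ⊛ p) u xor pr p      ≡⟨ cong (_xor pr p) p-unlit-at-u ⟩
  pr p                         ≡⟨ pr-solution G s-odd p-solves ⟩
  s · ‾ x[ u ]                 ≡⟨ ·-comm s (‾ x[ u ]) ⟩
  ‾ x[ u ] · s                 ≡⟨ ‾-· x[ u ] s ⟩
  x[ u ] · s xor pr s          ≡⟨ cong (_xor pr s) (x[]-· u s) ⟩
  s u xor pr s                 ∎
  where
  open ≡-Reasoning
  p-unlit-at-u : (Nmat G ⊛ p) u ≡ false
  p-unlit-at-u = trans (p-solves u) (cong (_xor true) (x[]-self u))

mainTheorem8 : ∀ (n : ℕ) (G : SimpleGraph n) → ν≡0 G → (u : Fin n) → (p s : Vec₂ n) → Solves G p (‾ x[ u ]) → Solves G s 𝟏 → (s u ≡ false → ‾ xN[ G , u ] · p ≡ pr s) × (s u ≡ true → ‾ xN[ G , u ] · p ≡ not (pr s))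
mainTheorem8 n G _ u p s p-solves s-odd =
    (λ s[u]≡0 → trans identity (cong (_xor pr s) s[u]≡0))
  , (λ s[u]≡1 → trans identity (cong (_xor pr s) s[u]≡1))
  where
  identity : ‾ xN[ G , u ] · p ≡ s u xor pr s
  identity = ‾xN·p≡s[u]⊕pr[s] G u p-solves s-odd
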